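{- Let $F$ be a CNF formula, $(T,\delta)$ a decomposition tree of $I(F)$, and let $x,y,z$ be nodes of $T$ such that $x$ and $y$ are the children of $z$. Let $\tau_x\in2^{\mathrm{var}_x}$ be of shape $(\mathit{out}_x,\mathit{in}_x)$ (a shape for $x$) and $\tau_y\in2^{\mathrm{var}_y}$ be of shape $(\mathit{out}_y,\mathit{in}_y)$ (a shape for $y$). If $(\mathit{out}_x,\mathit{in}_x)$ and $(\mathit{out}_y,\mathit{in}_y)$ generate the shape $(\mathit{out}_z,\mathit{in}_z)$ for $z$, then $\tau=\tau_x\cup\tau_y$ is of shape $(\mathit{out}_z,\mathit{in}_z)$. Moreover, if $(\mathit{out}_z,\mathit{in}_z)$ is proper then $(\mathit{out}_x,\mathit{in}_x)$ and $(\mathit{out}_y,\mathit{in}_y)$ are proper.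
   Context: A clause is a finite set of literals (variables $x$ or negations $\bar x$) not containing both $x$ and $\bar x$; a CNF formula $F$ is a finite set of clauses; $\mathrm{var}(C)$, $\mathrm{var}(F)$ denote occurring variables. The incidence graph $I(F)$ has vertex set $\mathrm{var}(F)\cup F$ and edges $Cx$ for $x\in\mathrm{var}(C)$. A decomposition tree of a graph is a pair $(T,\delta)$ with $T$ a rooted binary tree and $\delta$ a bijection from the leaves of $T$ to the vertex set. For a set of variables $X$, $2^X$ is the set of maps $\sigma:X\to\{0,1\}$ ($\sigma(\bar x)=1-\sigma(x)$); $\sigma$ satisfies clause $C$ if $\sigma(\ell)=1$ for some $\ell\in C$ with variable in $X$. For a set of clauses $G$, $G(\sigma)$ is the set of clauses of $G$ satisfied by $\sigma$, and $\mathrm{Proj}(G,X)=\{G(\sigma):\sigma\in2^X\}$. For assignments with disjoint domains, $\tau_x\cup\tau_y$ is their common extension. For a node $z$ of $T$ let $T_z$ be the subtree rooted at $z$ with leaf set $L(T_z)$; $\mathrm{var}_z=\mathrm{var}(F)\cap\delta(L(T_z))$, $F_z=F\cap\delta(L(T_z))$, $\overline{F_z}=F\setminus F_z$, $\overline{\mathrm{var}_z}=\mathrm{var}(F)\setminus\mathrm{var}_z$. A shape for $z$ is a pair $(\mathit{out},\mathit{in})$ with $\mathit{out}\subseteq\overline{F_z}$, $\mathit{in}\subseteq F_z$. An assignment $\tau\in2^{\mathrm{var}_z}$ is of shape $(\mathit{out},\mathit{in})$ if (i) $\overline{F_z}(\tau)=\mathit{out}$ and (ii) every clause $C\in F_z$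 is satisfied by $\tau$ or belongs to $\mathit{in}$. The shape is proper if $\mathit{out}\in\mathrm{Proj}(\overline{F_z},\mathrm{var}_z)$ and $\mathit{in}\in\mathrm{Proj}(F_z,\overline{\mathrm{var}_z})$. If $x,y$ are the children of $z$, shapes $(\mathit{out}_x,\mathit{in}_x)$ for $x$ and $(\mathit{out}_y,\mathit{in}_y)$ for $y$ generate the shape $(\mathit{out}_z,\mathit{in}_z)$ for $z$ if (1) $\mathit{out}_z=(\mathit{out}_x\cup\mathit{out}_y)\cap\overline{F_z}$, (2) $\mathit{in}_x=(\mathit{in}_z\cup\mathit{out}_y)\cap F_x$, and (3) $\mathit{in}_y=(\mathit{in}_z\cup\mathit{out}_x)\cap F_y$. -}

module Defs where

open import Data.Nat using (ℕ)
open import Data.Bool using (Bool; true; false; not; if_then_else_; _∧_; _∨_)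
open import Data.Maybe using (Maybe; just; nothing; is-just)
open import Data.Fin using (Fin)
open import Data.Fin.Subset as S using (Subset; ∁; _∩_; _∪_; _─_; _⊆_; ⁅_⁆)
open import Data.Vec using (tabulate; lookup)
open import Data.List using (List; []; _∷_; _++_; allFin)
open import Data.Bool.ListAction using (any)
import Data.List.Membership.Propositional as L
open import Data.List.Relation.Unary.Unique.Propositional using (Unique)
open import Data.Sum using (_⊎_; inj₁; inj₂)
open import Data.Product using (_×_; ∃)
open import Data.Unit using (⊤)
open import Relation.Binary.PropositionalEquality using (_≡_)

-- A clause is a map  Fin n → Maybe Bool :  nothing = variable does not
-- occur, just true = positive literal x, just false = negative literal x̄.
-- (So a clause never contains both x and x̄.)

Clause : ℕ → Set
Clause n = Fin n → Maybe Bool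

CNF : ℕ → ℕ → Set
CNF n m = Fin m → Clause n

-- F is a *set* of clauses: different indices denote different clauses.
DistinctClauses : ∀ {n m} → CNF n m → Set
DistinctClauses {n} F = ∀ i j → (∀ v → F i v ≡ F j v) → i ≡ j

varF : ∀ {n m} → CNF n m → Subset n
varF {m = m} F = tabulate (λ v → any (λ c → is-just (F c v)) (allFin m))

litTrue : Maybe Bool → Bool → Bool
litTrue nothing  _ = false
litTrue (just b) s = if b then s else not s

-- Assignments σ ∈ 2^X are represented by total maps Fin n → Bool of which
-- only the values on X are relevant: σ satisfies clause C (w.r.t. domain X)
-- iff some literal of C whose variable lies in X is made true.
satB : ∀ {n m} → CNF n m → Subset n → (Fin n → Bool) → Fin m → Bool
satB {n} F X σ c = any (λ v → lookup X v ∧ litTrue (F c v) (σ v)) (allFin n)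

satSet : ∀ {n m} → CNF n m → Subset m → Subset n → (Fin n → Bool) → Subset m
satSet F G X σ = G ∩ tabulate (satB F X σ)

InProj : ∀ {n m} → CNF n m → Subset m → Subset m → Subset n → Set
InProj {n} F S G X = ∃ λ (σ : Fin n → Bool) → satSet F G X σ ≡ S

Vertex : ℕ → ℕ → Set
Vertex n m = Fin n ⊎ Fin m

IsVertex : ∀ {n m} → CNF n m → Vertex n m → Set
IsVertex F (inj₁ v) = v S.∈ varF F
IsVertex F (inj₂ c) = ⊤

data Tree (A : Set) : Set where
  leaf : A → Tree A
  node : Tree A → Tree A → Tree A

leaves : ∀ {A} → Tree A → List A
leaves (leaf a)   = a ∷ []
leaves (node l r) = leaves l ++ leaves r

data _≼_ {A : Set} (t : Tree A) : Tree A → Set where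
  here  : t ≼ t
  left  : ∀ {l r} → t ≼ l → t ≼ node l r
  right : ∀ {l r} → t ≼ r → t ≼ node l r

-- (T, δ) is a decomposition tree of I(F): the leaf labelling δ is a
-- bijection from the leaves of T onto var(F) ∪ F.
IsDecompTree : ∀ {n m} → CNF n m → Tree (Vertex n m) → Set
IsDecompTree F T =
  Unique (leaves T) ×
  (∀ a → a L.∈ leaves T → IsVertex F a) ×
  (∀ a → IsVertex F a → a L.∈ leaves T)

leafVars : ∀ {n m} → Tree (Vertex n m) → Subset n
leafVars (leaf (inj₁ v)) = ⁅ v ⁆
leafVars (leaf (inj₂ c)) = S.⊥
leafVars (node l r)      = leafVars l ∪ leafVars r

leafClauses : ∀ {n m} → Tree (Vertex n m) → Subset m
leafClauses (leaf (inj₁ v)) = S.⊥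
leafClauses (leaf (inj₂ c)) = ⁅ c ⁆
leafClauses (node l r)      = leafClauses l ∪ leafClauses r

varAt : ∀ {n m} → CNF n m → Tree (Vertex n m) → Subset n
varAt F t = varF F ∩ leafVars t

FAt : ∀ {n m} → Tree (Vertex n m) → Subset m
FAt t = leafClauses t

coVarAt : ∀ {n m} → CNF n m → Tree (Vertex n m) → Subset n
coVarAt F t = varF F ─ varAt F t

coFAt : ∀ {n m} → Tree (Vertex n m) → Subset m
coFAt t = ∁ (FAt t)

IsShapeFor : ∀ {n m} → Tree (Vertex n m) → Subset m → Subset m → Set
IsShapeFor t out in' = out ⊆ coFAt t × in' ⊆ FAt t

OfShape : ∀ {n m} → CNF n m → Tree (Vertex n m) →
          (Fin n → Bool) → Subset m → Subset m → Set
OfShape {m = m} F t τ out in' =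
  satSet F (coFAt t) (varAt F t) τ ≡ out ×
  (∀ (c : Fin m) → c S.∈ FAt t →
     satB F (varAt F t) τ c ≡ true ⊎ c S.∈ in')

Proper : ∀ {n m} → CNF n m → Tree (Vertex n m) → Subset m → Subset m → Set
Proper F t out in' =
  InProj F out (coFAt t) (varAt F t) × InProj F in' (FAt t) (coVarAt F t)

Generates : ∀ {n m} → (tx ty : Tree (Vertex n m)) →
            (outx inx outy iny outz inz : Subset m) → Set
Generates tx ty outx inx outy iny outz inz =
  outz ≡ (outx ∪ outy) ∩ coFAt (node tx ty) ×
  inx ≡ (inz ∪ outy) ∩ FAt tx ×
  iny ≡ (inz ∪ outx) ∩ FAt ty

-- τ_x ∪ τ_y (domains var_x, var_y are disjoint)
unionAssign : ∀ {n m} → CNF n m → Tree (Vertex n m) →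
              (Fin n → Bool) → (Fin n → Bool) → Fin n → Bool
unionAssign F tx τx τy v = if lookup (varAt F tx) v then τx v else τy v

-- Since T is a decomposition tree, the leaves of T_x and T_y are disjoint, so var_z and F_z are
-- the disjoint unions of var_x, var_y and of F_x, F_y.  The clauses satisfied by τ_x ∪ τ_y are
-- then exactly those satisfied by τ_x or by τ_y, which gives the shape of τ_x ∪ τ_y by Boolean
-- algebra.  For properness: out_x is realised by τ_x itself, and if σ_z realises in_z then
-- σ_z ∪ τ_y on var(F) ∖ var_x = (var(F) ∖ var_z) ∪ var_y realises in_x = (in_z ∪ out_y) ∩ F_x.
module Submission where

open import Defs
open import Algebra.Bundles using (CommutativeMonoid)
open import Data.Nat using (ℕ)
open import Data.Bool using (Bool; true; false; not; _∧_; _∨_; if_then_else_)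
open import Data.Bool.Properties using (∨-commutativeMonoid; ∧-distribʳ-∨; ∧-zeroʳ; ∧-identityʳ)
open import Data.Bool.ListAction using (any; or)
open import Data.Fin using (Fin; zero; suc)
open import Data.Fin.Subset using (Subset; _∩_; _∪_; _─_; ∁) renaming (_∈_ to _∈ₛ_; ⊥ to ∅)
open import Data.Fin.Subset.Properties
  using (∩-comm; ∪-comm; ∩-distribˡ-∪; x∈p∩q⁻; x∈p∪q⁻; x∈p∪q⁺; x∈⁅y⁆⇒x≡y; ∉⊥; Empty-unique)
open import Data.Vec using ([]; _∷_; lookup; tabulate)
open import Data.Vec.Properties
  using (∷-injectiveˡ; ∷-injectiveʳ; lookup-zipWith; lookup∘tabulate; tabulate-cong; []=⇒lookup; lookup⇒[]=)
open import Data.List using (List; []; _∷_; _++_; allFin)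
open import Data.List.Properties using (map-cong)
open import Data.List.Membership.Propositional using (_∈_; _∉_)
open import Data.List.Membership.Propositional.Properties using (∈-++⁺ˡ; ∈-++⁺ʳ)
open import Data.List.Relation.Unary.Any using (here; there)
import Data.List.Relation.Unary.All as All
open import Data.List.Relation.Unary.All.Properties using (++⁻ˡ)
open import Data.List.Relation.Unary.AllPairs using ([]; _∷_)
open import Data.List.Relation.Unary.Unique.Propositional using (Unique)
open import Data.Sum using (_⊎_; inj₁; inj₂; [_,_]; swap)
import Data.Sum as Sum
open import Data.Product using (_×_; _,_; proj₁; proj₂)
open import Data.Empty using (⊥-elim)
open import Function using (_∘_)
open import Relation.Binary.PropositionalEquality
  using (_≡_; refl; sym; trans; cong; cong₂; subst; module ≡-Reasoning)
open import Algebra.Properties.CommutativeSemigroup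
  (CommutativeMonoid.commutativeSemigroup ∨-commutativeMonoid)
  using () renaming (interchange to ∨-interchange)

Disjoint : ∀ {k} → Subset k → Subset k → Set
Disjoint p q = p ∩ q ≡ ∅

Disjoint-sym : ∀ {k} {p q : Subset k} → Disjoint p q → Disjoint q p
Disjoint-sym {p = p} {q} p#q = trans (∩-comm q p) p#q

Disjoint-lookup : ∀ {k} {p q : Subset k} → Disjoint p q → ∀ i → lookup q i ≡ true → lookup p i ≡ false
Disjoint-lookup {p = a ∷ _} {_ ∷ _} p#q zero refl = trans (sym (∧-identityʳ a)) (∷-injectiveˡ p#q)
Disjoint-lookup {p = _ ∷ _} {_ ∷ _} p#q (suc i) = Disjoint-lookup (∷-injectiveʳ p#q) i

p─q≡p∩∁q : ∀ {k} (p q : Subset k) → p ─ q ≡ p ∩ ∁ q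
p─q≡p∩∁q []      []          = refl
p─q≡p∩∁q (a ∷ p) (true ∷ q)  = cong₂ _∷_ (sym (∧-zeroʳ a)) (p─q≡p∩∁q p q)
p─q≡p∩∁q (a ∷ p) (false ∷ q) = cong₂ _∷_ (sym (∧-identityʳ a)) (p─q≡p∩∁q p q)

∁[p∪q]∩[s∪t]≡[∁p∩s∪∁q∩t]∩∁[p∪q] : ∀ {k} (p q s t : Subset k) →
  ∁ (p ∪ q) ∩ (s ∪ t) ≡ (∁ p ∩ s ∪ ∁ q ∩ t) ∩ ∁ (p ∪ q)
∁[p∪q]∩[s∪t]≡[∁p∩s∪∁q∩t]∩∁[p∪q] [] [] [] [] = refl
∁[p∪q]∩[s∪t]≡[∁p∩s∪∁q∩t]∩∁[p∪q] (a ∷ p) (b ∷ q) (c ∷ s) (d ∷ t) =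
  cong₂ _∷_ (head a b c d) (∁[p∪q]∩[s∪t]≡[∁p∩s∪∁q∩t]∩∁[p∪q] p q s t)
  where
  head : ∀ a b c d → not (a ∨ b) ∧ (c ∨ d) ≡ ((not a ∧ c) ∨ (not b ∧ d)) ∧ not (a ∨ b)
  head true  _     _ _ = sym (∧-zeroʳ _)
  head false true  _ _ = sym (∧-zeroʳ _)
  head false false _ _ = sym (∧-identityʳ _)

p∩[s∪t]≡[[p∪q]∩s∪∁q∩t]∩p : ∀ {k} (p q s t : Subset k) → Disjoint p q →
  p ∩ (s ∪ t) ≡ ((p ∪ q) ∩ s ∪ ∁ q ∩ t) ∩ p
p∩[s∪t]≡[[p∪q]∩s∪∁q∩t]∩p [] [] [] [] _ = refl
p∩[s∪t]≡[[p∪q]∩s∪∁q∩t]∩p (a ∷ p) (b ∷ q) (c ∷ s) (d ∷ t) p#q =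
  cong₂ _∷_ (head a b c d (∷-injectiveˡ p#q)) (p∩[s∪t]≡[[p∪q]∩s∪∁q∩t]∩p p q s t (∷-injectiveʳ p#q))
  where
  head : ∀ a b c d → a ∧ b ≡ false → a ∧ (c ∨ d) ≡ (((a ∨ b) ∧ c) ∨ (not b ∧ d)) ∧ a
  head false _     _ _ _  = sym (∧-zeroʳ _)
  head true  false _ _ _  = sym (∧-identityʳ _)
  head true  true  _ _ ()

r∩∁p≡r∩∁[p∪r∩b]∪r∩b : ∀ {k} (r p b : Subset k) → Disjoint p (r ∩ b) →
  r ∩ ∁ p ≡ r ∩ ∁ (p ∪ r ∩ b) ∪ r ∩ b
r∩∁p≡r∩∁[p∪r∩b]∪r∩b [] [] [] _ = refl
r∩∁p≡r∩∁[p∪r∩b]∪r∩b (c ∷ r) (a ∷ p) (d ∷ b) p#rb =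
  cong₂ _∷_ (head c a d (∷-injectiveˡ p#rb)) (r∩∁p≡r∩∁[p∪r∩b]∪r∩b r p b (∷-injectiveʳ p#rb))
  where
  head : ∀ c a d → a ∧ (c ∧ d) ≡ false → c ∧ not a ≡ (c ∧ not (a ∨ (c ∧ d))) ∨ (c ∧ d)
  head false _     _     _  = refl
  head true  false false _  = refl
  head true  false true  _  = refl
  head true  true  false _  = refl
  head true  true  true  ()

r∩∁[p∪q]#q : ∀ {k} (r p q : Subset k) → Disjoint (r ∩ ∁ (p ∪ q)) q
r∩∁[p∪q]#q [] [] [] = refl
r∩∁[p∪q]#q (c ∷ r) (a ∷ p) (d ∷ q) = cong₂ _∷_ (head c a d) (r∩∁[p∪q]#q r p q)
  where
  head : ∀ c a d → (c ∧ not (a ∨ d)) ∧ d ≡ false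
  head false _     _     = refl
  head true  true  _     = refl
  head true  false true  = refl
  head true  false false = refl

tabulate-∨ : ∀ {k} (f g : Fin k → Bool) → tabulate (λ i → f i ∨ g i) ≡ tabulate f ∪ tabulate g
tabulate-∨ {ℕ.zero}  f g = refl
tabulate-∨ {ℕ.suc k} f g = cong ((f zero ∨ g zero) ∷_) (tabulate-∨ (f ∘ suc) (g ∘ suc))

any-∨ : ∀ {A : Set} (f g : A → Bool) xs → any (λ a → f a ∨ g a) xs ≡ any f xs ∨ any g xs
any-∨ f g []       = refl
any-∨ f g (x ∷ xs) = trans (cong ((f x ∨ g x) ∨_) (any-∨ f g xs)) (∨-interchange (f x) (g x) _ _)

outOf : ∀ {n m} → CNF n m → Tree (Vertex n m) → (Fin n → Bool) → Subset m
outOf F t τ = satSet F (coFAt t) (varAt F t) τ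

covered-by-child : ∀ {k} {c : Fin k} {S S′ G L inz : Subset k} →
  c ∈ₛ S ⊎ c ∈ₛ (inz ∪ G ∩ S′) ∩ L → c ∈ₛ inz ⊎ (c ∈ₛ S ⊎ c ∈ₛ S′)
covered-by-child (inj₁ c∈S) = inj₂ (inj₁ c∈S)
covered-by-child {S′ = S′} {G} {L} {inz} (inj₂ c∈in)
  with x∈p∪q⁻ inz (G ∩ S′) (proj₁ (x∈p∩q⁻ (inz ∪ G ∩ S′) L c∈in))
... | inj₁ c∈inz = inj₁ c∈inz
... | inj₂ c∈out = inj₂ (inj₂ (proj₂ (x∈p∩q⁻ G S′ c∈out)))

glue : ∀ {n} → Subset n → (Fin n → Bool) → (Fin n → Bool) → Fin n → Bool
glue X σ σ′ v = if lookup X v then σ v else σ′ v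

module _ {n m} (F : CNF n m) where

  satisfied : Subset n → (Fin n → Bool) → Subset m
  satisfied X σ = tabulate (satB F X σ)

  ∈-satisfied⁺ : ∀ X σ {c} → satB F X σ c ≡ true → c ∈ₛ satisfied X σ
  ∈-satisfied⁺ X σ {c} sat = lookup⇒[]= c _ (trans (lookup∘tabulate (satB F X σ) c) sat)

  ∈-satisfied⁻ : ∀ X σ {c} → c ∈ₛ satisfied X σ → satB F X σ c ≡ true
  ∈-satisfied⁻ X σ {c} c∈ = trans (sym (lookup∘tabulate (satB F X σ) c)) ([]=⇒lookup c∈)

  satB-∪ : ∀ X Y σ c → satB F (X ∪ Y) σ c ≡ satB F X σ c ∨ satB F Y σ c
  satB-∪ X Y σ c = trans (cong or (map-cong distrib (allFin n))) (any-∨ _ _ (allFin n))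
    where
    distrib : ∀ v → lookup (X ∪ Y) v ∧ litTrue (F c v) (σ v) ≡
                    (lookup X v ∧ litTrue (F c v) (σ v)) ∨ (lookup Y v ∧ litTrue (F c v) (σ v))
    distrib v = trans (cong (_∧ litTrue (F c v) (σ v)) (lookup-zipWith _∨_ v X Y))
                      (∧-distribʳ-∨ (litTrue (F c v) (σ v)) (lookup X v) (lookup Y v))

  satB-cong : ∀ X {σ σ′} c → (∀ v → lookup X v ≡ true → σ v ≡ σ′ v) → satB F X σ c ≡ satB F X σ′ c
  satB-cong X {σ} {σ′} c agree = cong or (map-cong pointwise (allFin n))
    where
    pointwise : ∀ v → lookup X v ∧ litTrue (F c v) (σ v) ≡ lookup X v ∧ litTrue (F c v) (σ′ v)
    pointwise v with lookup X v in X∋v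
    ... | true  = cong (litTrue (F c v)) (agree v X∋v)
    ... | false = refl

  satisfied-glue : ∀ X Y σ σ′ → Disjoint X Y →
    satisfied (X ∪ Y) (glue X σ σ′) ≡ satisfied X σ ∪ satisfied Y σ′
  satisfied-glue X Y σ σ′ X#Y =
    trans (tabulate-cong split) (tabulate-∨ (satB F X σ) (satB F Y σ′))
    where
    on-X : ∀ v → lookup X v ≡ true → glue X σ σ′ v ≡ σ v
    on-X v X∋v rewrite X∋v = refl
    on-Y : ∀ v → lookup Y v ≡ true → glue X σ σ′ v ≡ σ′ v
    on-Y v Y∋v rewrite Disjoint-lookup X#Y v Y∋v = refl
    split : ∀ c → satB F (X ∪ Y) (glue X σ σ′) c ≡ satB F X σ c ∨ satB F Y σ′ c
    split c = trans (satB-∪ X Y _ c) (cong₂ _∨_ (satB-cong X c on-X) (satB-cong Y c on-Y))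

  -- The equations for coVz and Lz let the lemma serve both children, whose unions with the
  -- sibling come in opposite orders.
  inProj-sibling : ∀ {V Bo Vw coVz : Subset n} {Lw Lo Lz inz : Subset m} τo →
    Disjoint Vw (V ∩ Bo) → Disjoint Lw Lo → coVz ≡ V ∩ ∁ (Vw ∪ V ∩ Bo) → Lz ≡ Lw ∪ Lo →
    InProj F inz Lz coVz → InProj F ((inz ∪ satSet F (∁ Lo) (V ∩ Bo) τo) ∩ Lw) Lw (V ─ Vw)
  inProj-sibling {V} {Bo} {Vw} {coVz} {Lw} {Lo} τo Vw#Vo Lw#Lo refl refl (σz , refl) =
    glue coVz σz τo , (begin
      Lw ∩ satisfied (V ─ Vw) σ                          ≡⟨ cong (λ X → Lw ∩ satisfied X σ) coVw-split ⟩
      Lw ∩ satisfied (coVz ∪ V ∩ Bo) σ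
        ≡⟨ cong (Lw ∩_) (satisfied-glue coVz (V ∩ Bo) σz τo (r∩∁[p∪q]#q V Vw (V ∩ Bo))) ⟩
      Lw ∩ (satisfied coVz σz ∪ satisfied (V ∩ Bo) τo)   ≡⟨ p∩[s∪t]≡[[p∪q]∩s∪∁q∩t]∩p Lw Lo _ _ Lw#Lo ⟩
      ((Lw ∪ Lo) ∩ satisfied coVz σz ∪ ∁ Lo ∩ satisfied (V ∩ Bo) τo) ∩ Lw ∎)
    where
    open ≡-Reasoning
    σ : Fin n → Bool
    σ = glue coVz σz τo
    coVw-split : V ─ Vw ≡ coVz ∪ V ∩ Bo
    coVw-split = trans (p─q≡p∩∁q V Vw) (r∩∁p≡r∩∁[p∪r∩b]∪r∩b V Vw Bo Vw#Vo)

Unique-++⁻ˡ : ∀ {A : Set} (xs : List A) {ys} → Unique (xs ++ ys) → Unique xs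
Unique-++⁻ˡ []       _            = []
Unique-++⁻ˡ (x ∷ xs) (x∉xs++ys ∷ u) = ++⁻ˡ xs x∉xs++ys ∷ Unique-++⁻ˡ xs u

Unique-++⁻ʳ : ∀ {A : Set} (xs : List A) {ys} → Unique (xs ++ ys) → Unique ys
Unique-++⁻ʳ []       u       = u
Unique-++⁻ʳ (x ∷ xs) (_ ∷ u) = Unique-++⁻ʳ xs u

Unique-++⇒∉ : ∀ {A : Set} (xs : List A) {ys a} → Unique (xs ++ ys) → a ∈ xs → a ∉ ys
Unique-++⇒∉ (x ∷ xs) (x∉xs++ys ∷ _) (here refl) a∈ys = All.lookup x∉xs++ys (∈-++⁺ʳ xs a∈ys) refl
Unique-++⇒∉ (x ∷ xs) (_ ∷ u)        (there a∈xs) a∈ys = Unique-++⇒∉ xs u a∈xs a∈ys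

Unique-≼ : ∀ {A : Set} {t T : Tree A} → t ≼ T → Unique (leaves T) → Unique (leaves t)
Unique-≼ here              u = u
Unique-≼ (left {l} t≼l)    u = Unique-≼ t≼l (Unique-++⁻ˡ (leaves l) u)
Unique-≼ (right {l} t≼r)   u = Unique-≼ t≼r (Unique-++⁻ʳ (leaves l) u)

Disjoint-from-Unique : ∀ {A : Set} {k} (f : Fin k → A) {p q : Subset k} (xs : List A) {ys} →
  Unique (xs ++ ys) → (∀ {i} → i ∈ₛ p → f i ∈ xs) → (∀ {i} → i ∈ₛ q → f i ∈ ys) → Disjoint p q
Disjoint-from-Unique f {p} {q} xs u p⊆xs q⊆ys = Empty-unique λ (i , i∈p∩q) →
  let i∈p , i∈q = x∈p∩q⁻ p q i∈p∩q in Unique-++⇒∉ xs u (p⊆xs i∈p) (q⊆ys i∈q)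

∈-leafVars : ∀ {n m} (t : Tree (Vertex n m)) {v} → v ∈ₛ leafVars t → inj₁ v ∈ leaves t
∈-leafVars (leaf (inj₁ w)) v∈ = here (cong inj₁ (x∈⁅y⁆⇒x≡y w v∈))
∈-leafVars (leaf (inj₂ _)) v∈ = ⊥-elim (∉⊥ v∈)
∈-leafVars (node l r)      v∈ =
  [ ∈-++⁺ˡ ∘ ∈-leafVars l , ∈-++⁺ʳ (leaves l) ∘ ∈-leafVars r ] (x∈p∪q⁻ (leafVars l) (leafVars r) v∈)

∈-leafClauses : ∀ {n m} (t : Tree (Vertex n m)) {c} → c ∈ₛ leafClauses t → inj₂ c ∈ leaves t
∈-leafClauses (leaf (inj₁ _)) c∈ = ⊥-elim (∉⊥ c∈)
∈-leafClauses (leaf (inj₂ d)) c∈ = here (cong inj₂ (x∈⁅y⁆⇒x≡y d c∈))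
∈-leafClauses (node l r)      c∈ =
  [ ∈-++⁺ˡ ∘ ∈-leafClauses l , ∈-++⁺ʳ (leaves l) ∘ ∈-leafClauses r ]
    (x∈p∪q⁻ (leafClauses l) (leafClauses r) c∈)

varAt-disjoint : ∀ {n m} (F : CNF n m) (l r : Tree (Vertex n m)) →
  Unique (leaves (node l r)) → Disjoint (varAt F l) (varAt F r)
varAt-disjoint F l r u = Disjoint-from-Unique inj₁ (leaves l) u
  (λ v∈ → ∈-leafVars l (proj₂ (x∈p∩q⁻ (varF F) _ v∈)))
  (λ v∈ → ∈-leafVars r (proj₂ (x∈p∩q⁻ (varF F) _ v∈)))

FAt-disjoint : ∀ {n m} (l r : Tree (Vertex n m)) → Unique (leaves (node l r)) → Disjoint (FAt l) (FAt r)
FAt-disjoint l r u = Disjoint-from-Unique inj₂ (leaves l) u (∈-leafClauses l) (∈-leafClauses r)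

module SiblingShapes {n m} (F : CNF n m) (tx ty : Tree (Vertex n m))
  (Vx#Vy : Disjoint (varAt F tx) (varAt F ty)) (Lx#Ly : Disjoint (FAt tx) (FAt ty)) where

  Lx Ly : Subset m
  Lx = FAt tx
  Ly = FAt ty

  coVarAt-node : coVarAt F (node tx ty) ≡ varF F ∩ ∁ (varAt F tx ∪ varAt F ty)
  coVarAt-node = trans (p─q≡p∩∁q (varF F) _)
    (cong (λ X → varF F ∩ ∁ X) (∩-distribˡ-∪ (varF F) (leafVars tx) (leafVars ty)))

  satisfied-unionAssign : ∀ τx τy → satisfied F (varAt F (node tx ty)) (unionAssign F tx τx τy) ≡
    satisfied F (varAt F tx) τx ∪ satisfied F (varAt F ty) τy
  satisfied-unionAssign τx τy =
    trans (cong (λ X → satisfied F X (unionAssign F tx τx τy))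
                (∩-distribˡ-∪ (varF F) (leafVars tx) (leafVars ty)))
          (satisfied-glue F (varAt F tx) (varAt F ty) τx τy Vx#Vy)

  unionAssign-ofShape : ∀ {inz} τx τy →
    (∀ c → c ∈ₛ Lx → satB F (varAt F tx) τx c ≡ true ⊎ c ∈ₛ (inz ∪ outOf F ty τy) ∩ Lx) →
    (∀ c → c ∈ₛ Ly → satB F (varAt F ty) τy c ≡ true ⊎ c ∈ₛ (inz ∪ outOf F tx τx) ∩ Ly) →
    OfShape F (node tx ty) (unionAssign F tx τx τy)
            ((outOf F tx τx ∪ outOf F ty τy) ∩ coFAt (node tx ty)) inz
  unionAssign-ofShape {inz} τx τy x-covered y-covered =
    trans (cong (∁ (Lx ∪ Ly) ∩_) (satisfied-unionAssign τx τy))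
          (∁[p∪q]∩[s∪t]≡[∁p∩s∪∁q∩t]∩∁[p∪q] Lx Ly Sx Sy) ,
    λ c c∈Lz → [ inj₂ , inj₁ ∘ satisfied-by-union c ] (from-children c (x∈p∪q⁻ Lx Ly c∈Lz))
    where
    Sx Sy : Subset m
    Sx = satisfied F (varAt F tx) τx
    Sy = satisfied F (varAt F ty) τy
    from-children : ∀ c → c ∈ₛ Lx ⊎ c ∈ₛ Ly → c ∈ₛ inz ⊎ (c ∈ₛ Sx ⊎ c ∈ₛ Sy)
    from-children c (inj₁ c∈Lx) =
      covered-by-child (Sum.map₁ (∈-satisfied⁺ F (varAt F tx) τx) (x-covered c c∈Lx))
    from-children c (inj₂ c∈Ly) =
      Sum.map₂ swap (covered-by-child (Sum.map₁ (∈-satisfied⁺ F (varAt F ty) τy) (y-covered c c∈Ly)))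
    satisfied-by-union : ∀ c → c ∈ₛ Sx ⊎ c ∈ₛ Sy →
      satB F (varAt F (node tx ty)) (unionAssign F tx τx τy) c ≡ true
    satisfied-by-union c = ∈-satisfied⁻ F (varAt F (node tx ty)) (unionAssign F tx τx τy)
                         ∘ subst (c ∈ₛ_) (sym (satisfied-unionAssign τx τy)) ∘ x∈p∪q⁺

  proper-children : ∀ {outz inz} τx τy → Proper F (node tx ty) outz inz →
    Proper F tx (outOf F tx τx) ((inz ∪ outOf F ty τy) ∩ Lx) ×
    Proper F ty (outOf F ty τy) ((inz ∪ outOf F tx τx) ∩ Ly)
  proper-children τx τy (_ , inz-realised) =
    ((τx , refl) , inProj-sibling F τy Vx#Vy Lx#Ly coVarAt-node refl inz-realised) ,
    ((τy , refl) , inProj-sibling F τx (Disjoint-sym Vx#Vy) (Disjoint-sym Lx#Ly)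
                     (trans coVarAt-node (cong (λ X → varF F ∩ ∁ X) (∪-comm (varAt F tx) (varAt F ty))))
                     (∪-comm Lx Ly) inz-realised)

lemma3 : (n m : ℕ) (F : CNF n m) → DistinctClauses F →
    (T : Tree (Vertex n m)) → IsDecompTree F T →
    (tx ty : Tree (Vertex n m)) → node tx ty ≼ T →
    (outx inx outy iny outz inz : Subset m) →
    IsShapeFor tx outx inx → IsShapeFor ty outy iny →
    IsShapeFor (node tx ty) outz inz →
    (τx τy : Fin n → Bool) →
    OfShape F tx τx outx inx → OfShape F ty τy outy iny →
    Generates tx ty outx inx outy iny outz inz →
    OfShape F (node tx ty) (unionAssign F tx τx τy) outz inz ×
    (Proper F (node tx ty) outz inz →
      Proper F tx outx inx × Proper F ty outy iny)
lemma3 n m F _ T (unique , _) tx ty z≼T ._ ._ ._ ._ ._ inz _ _ _ τx τy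
       (refl , x-covered) (refl , y-covered) (refl , refl , refl) =
  unionAssign-ofShape τx τy x-covered y-covered , proper-children τx τy
  where
  z-unique : Unique (leaves (node tx ty))
  z-unique = Unique-≼ z≼T unique
  open SiblingShapes F tx ty (varAt-disjoint F tx ty z-unique) (FAt-disjoint tx ty z-unique)
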